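{- Let $u \in \mathcal{A}^*$. Then $u$ is highest-weight (that is, $\ddot e_i(u)$ is undefined for every $i \in \mathbb{N}$) if and only if $\mathrm{rtree}(u)$ has the following property: if the right interval partition of $\mathrm{rtree}(u)$ has $\ell$ parts, then for each $a \in \{1,\ldots,\ell\}$, all nodes in the $a$-th right interval are labelled by $a$.
   Context: $\mathcal{A} = \{1,2,3,\ldots\}$ with the usual order; $\mathcal{A}^*$ the free monoid over $\mathcal{A}$. Quasi-Kashiwara raising operator $\ddot e_i$ ($i \in \mathbb{N}$): if $u$ contains a letter $i+1$ somewhere to the left of a letter $i$, $\ddot e_i(u)$ is undefined; otherwise $\ddot e_i(u)$ is obtained by replacing the leftmost letter $i+1$ of $u$ by $i$, and is undefined if $u$ contains no $i+1$. A right strict binary search tree is a labelled rooted binary tree in which each node's label is $\ge$ all labels in its left subtree and $<$ all labels in its right subtree. $\mathrm{rtree}(a_1\cdots a_k)$ is obtained from the empty tree by inserting $a_k, a_{k-1},\ldots,a_1$ in turn, where inserting $a$ creates a node labelled $a$ if the tree is empty and otherwise recurses into the left subtree if $a \le$ the root label and into the right subtree otherwise. The infix traversal of a binary tree recursively traverses the left subtree, visits the root, then traverses the right subtree. If $x_1,\ldots,x_m$ are the nodes in infix order, the right interval partition of the tree is obtained by cutting the sequence $x_1,\ldots,x_m$ immediately after each node that has a non-empty right subtree; the resulting consecutive blocks, in order, are the $1$st, $2$nd, $\ldots$ right intervals. -}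

module Defs where

open import Data.Nat using (ℕ; zero; suc; _≤_; _≤ᵇ_; _≡ᵇ_)
open import Data.Bool using (Bool; true; false; if_then_else_; _∧_; _∨_; not)
open import Data.List using (List; []; _∷_; _++_; foldr; length)
open import Data.Maybe using (Maybe; just; nothing)
open import Data.Fin using (Fin; toℕ)
open import Data.Product using (_×_; _,_)
open import Relation.Binary.PropositionalEquality using (_≡_)
open import Data.List.Relation.Unary.All using (All)

-- Words over the alphabet A = {1,2,3,...}; letters are represented by natural
-- numbers, and the statement requires every letter to be ≥ 1.
Word : Set
Word = List ℕ

containsLetter : ℕ → Word → Bool
containsLetter k [] = false
containsLetter k (x ∷ u) = (x ≡ᵇ k) ∨ containsLetter k u

leftOf : ℕ → ℕ → Word → Bool
leftOf j k [] = false
leftOf j k (x ∷ u) = ((x ≡ᵇ j) ∧ containsLetter k u) ∨ leftOf j k u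

replaceLeftmost : ℕ → ℕ → Word → Maybe Word
replaceLeftmost j k [] = nothing
replaceLeftmost j k (x ∷ u) with x ≡ᵇ j
... | true  = just (k ∷ u)
... | false with replaceLeftmost j k u
...   | just w  = just (x ∷ w)
...   | nothing = nothing

quasiRaise : ℕ → Word → Maybe Word
quasiRaise i u =
  if leftOf (suc i) i u then nothing else replaceLeftmost (suc i) i u

HighestWeight : Word → Set
HighestWeight u = ∀ i → 1 ≤ i → quasiRaise i u ≡ nothing

data Tree : Set where
  leaf : Tree
  node : Tree → ℕ → Tree → Tree

insert : ℕ → Tree → Tree
insert a leaf = node leaf a leaf
insert a (node l b r) = if a ≤ᵇ b then node (insert a l) b r else node l b (insert a r)

rtree : Word → Tree
rtree u = foldr insert leaf u

isLeaf : Tree → Bool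
isLeaf leaf = true
isLeaf (node _ _ _) = false

infixNodes : Tree → List (ℕ × Bool)
infixNodes leaf = []
infixNodes (node l a r) = infixNodes l ++ ((a , not (isLeaf r)) ∷ infixNodes r)

-- cut the infix sequence immediately after each node with non-empty right subtree
cutBlocks : List (ℕ × Bool) → List (List ℕ)
cutBlocks [] = []
cutBlocks ((a , true) ∷ xs) = (a ∷ []) ∷ cutBlocks xs
cutBlocks ((a , false) ∷ xs) with cutBlocks xs
... | []       = (a ∷ []) ∷ []
... | (b ∷ bs) = (a ∷ b) ∷ bs

rightIntervals : Tree → List (List ℕ)
rightIntervals t = cutBlocks (infixNodes t)

-- the a-th right interval (a ∈ {1,…,ℓ}); index a-1 of the list
nth : List (List ℕ) → ℕ → List ℕ
nth [] _ = []
nth (b ∷ bs) zero = b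
nth (b ∷ bs) (suc n) = nth bs n

IntervalsLabelled : Tree → Set
IntervalsLabelled t =
  ∀ a → 1 ≤ a → a ≤ length (rightIntervals t) →
    All (λ x → x ≡ a) (nth (rightIntervals t) (Data.Nat.pred a))

-- The infix traversal of rtree u lists the letters of u in weakly increasing order, and when both
-- a and a+1 occur in u, the last node labelled a has a non-empty right subtree exactly when some
-- a+1 lies to the left of some a in u. The right intervals are constant and labelled 1, 2, … in
-- turn iff the letters form an initial segment {1,…,m} and each such last a has a right subtree;
-- since ë_i(u) is undefined iff i+1 is absent or some i+1 precedes some i, this is exactly the
-- highest-weight condition.
module Submission where

open import Defs
open import Data.Bool using (Bool; true; false; if_then_else_; _∧_; _∨_; not; T)
open import Data.Bool.Properties using (T-≡; ∧-identityʳ; ∨-zeroʳ; ∨-identityʳ; ∨-conicalˡ; ∨-conicalʳ; ∧-zeroʳ)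
open import Data.Empty using (⊥; ⊥-elim)
open import Data.List using (List; []; _∷_; _++_; foldr; length; map)
open import Data.List.Relation.Unary.All as All using (All; []; _∷_)
open import Data.Maybe using (nothing)
open import Data.Nat using (ℕ; zero; suc; _≤_; _<_; _+_; _≤ᵇ_; _≡ᵇ_; z≤n; s≤s)
open import Data.Nat.Properties
open import Data.Product using (_×_; _,_; proj₁)
open import Data.Sum using (inj₁; inj₂)
open import Data.Unit using (⊤; tt)
open import Function.Base using (_∘_)
open import Level using (0ℓ)
open import Function.Bundles using (_⇔_; mk⇔; Equivalence)
open import Relation.Binary.Definitions using (tri<; tri≈; tri>)
open import Relation.Binary.PropositionalEquality
open import Relation.Nullary using (yes; no)
import Relation.Binary.Reasoning.Setoid as SetoidReasoning
open import Function.Properties.Equivalence using (⇔-setoid)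

private
  variable
    m n : ℕ

≤ᵇ-true⇒≤ : (m ≤ᵇ n) ≡ true → m ≤ n
≤ᵇ-true⇒≤ {m} {n} e = ≤ᵇ⇒≤ m n (Equivalence.from T-≡ e)

≤ᵇ-false⇒> : (m ≤ᵇ n) ≡ false → n < m
≤ᵇ-false⇒> e = ≰⇒> (λ m≤n → subst T e (≤⇒≤ᵇ m≤n))

>⇒≤ᵇ-false : n < m → (m ≤ᵇ n) ≡ false
>⇒≤ᵇ-false {n} {m} n<m with m ≤ᵇ n in e
... | false = refl
... | true  = ⊥-elim (<⇒≱ n<m (≤ᵇ-true⇒≤ e))

≡ᵇ-true⇒≡ : (m ≡ᵇ n) ≡ true → m ≡ n
≡ᵇ-true⇒≡ {m} {n} e = ≡ᵇ⇒≡ m n (Equivalence.from T-≡ e)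

≡ᵇ-refl : ∀ m → (m ≡ᵇ m) ≡ true
≡ᵇ-refl m = Equivalence.to T-≡ (≡⇒≡ᵇ m m refl)

≢⇒≡ᵇ-false : m ≢ n → (m ≡ᵇ n) ≡ false
≢⇒≡ᵇ-false {m} {n} m≢n with m ≡ᵇ n in e
... | false = refl
... | true  = ⊥-elim (m≢n (≡ᵇ-true⇒≡ e))

by-cases : {P : Set} (b : Bool) → (b ≡ true → P) → (b ≡ false → P) → P
by-cases true  t f = t refl
by-cases false t f = f refl

∨-trueˡ : ∀ {p q} → q ≡ false → p ∨ q ≡ true → p ≡ true
∨-trueˡ {p} q≡false e = trans (sym (∨-identityʳ p)) (subst (λ q → p ∨ q ≡ true) q≡false e)

∨-trueʳ : ∀ {p q} → p ≡ false → p ∨ q ≡ true → q ≡ true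
∨-trueʳ refl e = e

∨-introˡ : ∀ {p q} → p ≡ true → p ∨ q ≡ true
∨-introˡ refl = refl

∨-introʳ : ∀ p {q} → q ≡ true → p ∨ q ≡ true
∨-introʳ p refl = ∨-zeroʳ p

∨-swap : ∀ p q r → p ∨ (q ∨ r) ≡ q ∨ (p ∨ r)
∨-swap true  true  r = refl
∨-swap true  false r = refl
∨-swap false q     r = refl

-- Right intervals

Entry : Set
Entry = ℕ × Bool

labels : List Entry → List ℕ
labels = map proj₁

LabelledFrom : ℕ → List Entry → Set
LabelledFrom k []                  = ⊤
LabelledFrom k ((a , true)  ∷ xs) = a ≡ k × LabelledFrom (suc k) xs
LabelledFrom k ((a , false) ∷ xs) = a ≡ k × LabelledFrom k xs

BlocksLabelledFrom : ℕ → List (List ℕ) → Set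
BlocksLabelledFrom k []       = ⊤
BlocksLabelledFrom k (b ∷ bs) = All (_≡ k) b × BlocksLabelledFrom (suc k) bs

labelledFrom⇒blocks : ∀ k L → LabelledFrom k L → BlocksLabelledFrom k (cutBlocks L)
labelledFrom⇒blocks k []                  _ = tt
labelledFrom⇒blocks k ((a , true)  ∷ xs) (a≡k , lf) = (a≡k ∷ []) , labelledFrom⇒blocks (suc k) xs lf
labelledFrom⇒blocks k ((a , false) ∷ xs) (a≡k , lf)
  with cutBlocks xs | labelledFrom⇒blocks k xs lf
... | []     | _          = (a≡k ∷ []) , tt
... | b ∷ bs | (pb , pbs) = (a≡k ∷ pb) , pbs

blocks⇒labelledFrom : ∀ k L → BlocksLabelledFrom k (cutBlocks L) → LabelledFrom k L
blocks⇒labelledFrom k [] _ = tt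
blocks⇒labelledFrom k ((a , true) ∷ xs) ((a≡k ∷ []) , pbs) = a≡k , blocks⇒labelledFrom (suc k) xs pbs
blocks⇒labelledFrom k ((a , false) ∷ xs) p with cutBlocks xs | blocks⇒labelledFrom k xs
blocks⇒labelledFrom k ((a , false) ∷ xs) ((a≡k ∷ []) , _)   | []     | ih = a≡k , ih tt
blocks⇒labelledFrom k ((a , false) ∷ xs) ((a≡k ∷ pb) , pbs) | b ∷ bs | ih = a≡k , ih (pb , pbs)

blocksLabelledFrom⇔nth : ∀ k bs →
  BlocksLabelledFrom k bs ⇔ (∀ j → j < length bs → All (_≡ k + j) (nth bs j))
blocksLabelledFrom⇔nth k bs = mk⇔ (to k bs) (from k bs)
  where
  to : ∀ k bs → BlocksLabelledFrom k bs → ∀ j → j < length bs → All (_≡ k + j) (nth bs j)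
  to k (b ∷ bs) (pb , _)   zero    _         = subst (λ c → All (_≡ c) b) (sym (+-identityʳ k)) pb
  to k (b ∷ bs) (_  , pbs) (suc j) (s≤s j<) =
    subst (λ c → All (_≡ c) (nth bs j)) (sym (+-suc k j)) (to (suc k) bs pbs j j<)
  from : ∀ k bs → (∀ j → j < length bs → All (_≡ k + j) (nth bs j)) → BlocksLabelledFrom k bs
  from k []       _ = tt
  from k (b ∷ bs) h =
    subst (λ c → All (_≡ c) b) (+-identityʳ k) (h zero (s≤s z≤n)) ,
    from (suc k) bs (λ j j< → subst (λ c → All (_≡ c) (nth bs j)) (+-suc k j) (h (suc j) (s≤s j<)))

intervalsLabelled⇔labelledFrom : ∀ t → IntervalsLabelled t ⇔ LabelledFrom 1 (infixNodes t)
intervalsLabelled⇔labelledFrom t = mk⇔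
  (λ il → blocks⇒labelledFrom 1 (infixNodes t)
            (Equivalence.from (blocksLabelledFrom⇔nth 1 _) (λ j j< → il (suc j) (s≤s z≤n) j<)))
  (λ lf → λ { (suc j) _ j< → Equivalence.to (blocksLabelledFrom⇔nth 1 _)
                                (labelledFrom⇒blocks 1 (infixNodes t) lf) j j< })

-- The infix traversal of rtree u

fitsBefore : ℕ → List Entry → Bool
fitsBefore x []            = true
fitsBefore x ((c , _) ∷ _) = x ≤ᵇ c

-- Insertion of x into the tree, seen on its infix traversal: x lands just before the first label
-- ≥ x, and if it lands after an entry, it lies in that entry's (now non-empty) right subtree.
insertInfix : ℕ → List Entry → List Entry
insertInfix x []            = (x , false) ∷ []
insertInfix x ((b , f) ∷ L) =
  if x ≤ᵇ b then (x , false) ∷ (b , f) ∷ L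
  else if fitsBefore x L then (b , true) ∷ (x , false) ∷ L
  else (b , f) ∷ insertInfix x L

infixList : Word → List Entry
infixList = foldr insertInfix []

insertInfix-fitsBefore : ∀ x L → fitsBefore x L ≡ true → insertInfix x L ≡ (x , false) ∷ L
insertInfix-fitsBefore x []            _ = refl
insertInfix-fitsBefore x ((c , g) ∷ L) e rewrite e = refl

fitsBefore-++ : ∀ x A b g R → (x ≤ᵇ b) ≡ true → fitsBefore x (A ++ (b , g) ∷ R) ≡ fitsBefore x A
fitsBefore-++ x []      b g R e = e
fitsBefore-++ x (_ ∷ _) b g R e = refl

insertInfix-++ˡ : ∀ x A b g R → (x ≤ᵇ b) ≡ true →
                  insertInfix x (A ++ (b , g) ∷ R) ≡ insertInfix x A ++ (b , g) ∷ R
insertInfix-++ˡ x []            b g R e rewrite e = refl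
insertInfix-++ˡ x ((a , f) ∷ A) b g R e with x ≤ᵇ a
... | true  = refl
... | false rewrite fitsBefore-++ x A b g R e with fitsBefore x A
...   | true  = refl
...   | false = cong ((a , f) ∷_) (insertInfix-++ˡ x A b g R e)

fitsBefore-++-false : ∀ x A b g R → All (λ c → (x ≤ᵇ c) ≡ false) (labels A) → (x ≤ᵇ b) ≡ false →
                      fitsBefore x (A ++ (b , g) ∷ R) ≡ false
fitsBefore-++-false x []      b g R _         x≰b = x≰b
fitsBefore-++-false x (_ ∷ _) b g R (x≰c ∷ _) _   = x≰c

insertInfix-++ʳ : ∀ x A b g R → All (λ c → (x ≤ᵇ c) ≡ false) (labels A) → (x ≤ᵇ b) ≡ false →
                  insertInfix x (A ++ (b , g) ∷ R) ≡ A ++ insertInfix x ((b , g) ∷ R)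
insertInfix-++ʳ x []            b g R _           _ = refl
insertInfix-++ʳ x ((a , f) ∷ A) b g R (x≰a ∷ x≰A) x≰b
  rewrite x≰a | fitsBefore-++-false x A b g R x≰A x≰b =
  cong ((a , f) ∷_) (insertInfix-++ʳ x A b g R x≰A x≰b)

insertInfix-rightChild : ∀ x b r → (x ≤ᵇ b) ≡ false →
  insertInfix x ((b , not (isLeaf r)) ∷ infixNodes r) ≡ (b , true) ∷ insertInfix x (infixNodes r)
insertInfix-rightChild x b leaf         x≰b rewrite x≰b = refl
insertInfix-rightChild x b (node l c r) x≰b rewrite x≰b
  with fitsBefore x (infixNodes (node l c r)) in fits
... | true  = cong ((b , true) ∷_) (sym (insertInfix-fitsBefore x _ fits))
... | false = refl

isLeaf-insert : ∀ x t → isLeaf (insert x t) ≡ false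
isLeaf-insert x leaf         = refl
isLeaf-insert x (node l b r) with x ≤ᵇ b
... | true  = refl
... | false = refl

All-insertInfix : ∀ {P : ℕ → Set} x L → P x → All P (labels L) → All P (labels (insertInfix x L))
All-insertInfix x []            px _         = px ∷ []
All-insertInfix x ((b , f) ∷ L) px (pb ∷ pL) with x ≤ᵇ b
... | true = px ∷ pb ∷ pL
... | false with fitsBefore x L
...   | true  = pb ∷ px ∷ pL
...   | false = pb ∷ All-insertInfix x L px pL

LeftBounded : Tree → Set
LeftBounded leaf         = ⊤
LeftBounded (node l b r) = LeftBounded l × LeftBounded r × All (_≤ b) (labels (infixNodes l))

infixNodes-insert : ∀ x t → LeftBounded t → infixNodes (insert x t) ≡ insertInfix x (infixNodes t)
infixNodes-insert x leaf         _               = refl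
infixNodes-insert x (node l b r) (lb , rb , l≤b) with x ≤ᵇ b in e
... | true rewrite infixNodes-insert x l lb = sym (insertInfix-++ˡ x (infixNodes l) b _ (infixNodes r) e)
... | false rewrite infixNodes-insert x r rb | isLeaf-insert x r = begin
  infixNodes l ++ (b , true) ∷ insertInfix x (infixNodes r)
    ≡⟨ cong (infixNodes l ++_) (insertInfix-rightChild x b r e) ⟨
  infixNodes l ++ insertInfix x ((b , not (isLeaf r)) ∷ infixNodes r)
    ≡⟨ insertInfix-++ʳ x (infixNodes l) b _ (infixNodes r) x≰l e ⟨
  insertInfix x (infixNodes l ++ (b , not (isLeaf r)) ∷ infixNodes r) ∎
  where
  open ≡-Reasoning
  x≰l : All (λ c → (x ≤ᵇ c) ≡ false) (labels (infixNodes l))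
  x≰l = All.map (λ c≤b → >⇒≤ᵇ-false {m = x} (≤-<-trans c≤b (≤ᵇ-false⇒> e))) l≤b

leftBounded-insert : ∀ x t → LeftBounded t → LeftBounded (insert x t)
leftBounded-insert x leaf         _               = tt , tt , []
leftBounded-insert x (node l b r) (lb , rb , l≤b) with x ≤ᵇ b in e
... | true  = leftBounded-insert x l lb , rb ,
  subst (λ L → All (_≤ b) (labels L)) (sym (infixNodes-insert x l lb))
        (All-insertInfix x (infixNodes l) (≤ᵇ-true⇒≤ e) l≤b)
... | false = lb , leftBounded-insert x r rb , l≤b

leftBounded-rtree : ∀ u → LeftBounded (rtree u)
leftBounded-rtree []      = tt
leftBounded-rtree (x ∷ u) = leftBounded-insert x (rtree u) (leftBounded-rtree u)

infixNodes-rtree : ∀ u → infixNodes (rtree u) ≡ infixList u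
infixNodes-rtree []      = refl
infixNodes-rtree (x ∷ u) =
  trans (infixNodes-insert x (rtree u) (leftBounded-rtree u)) (cong (insertInfix x) (infixNodes-rtree u))

HeadAbove : ℕ → List Entry → Set
HeadAbove a []            = ⊥
HeadAbove a ((b , _) ∷ _) = a < b

-- The infix successor of a node with a right subtree lies in that subtree, so its label is larger.
Ordered : List Entry → Set
Ordered []            = ⊤
Ordered ((a , f) ∷ L) = Ordered L × All (a ≤_) (labels L) × (f ≡ true → HeadAbove a L)

fitsBefore⇒All≤ : ∀ x L → Ordered L → fitsBefore x L ≡ true → All (x ≤_) (labels L)
fitsBefore⇒All≤ x []            _           _    = []
fitsBefore⇒All≤ x ((c , g) ∷ M) (_ , c≤M , _) fits =
  ≤ᵇ-true⇒≤ fits ∷ All.map (≤-trans (≤ᵇ-true⇒≤ fits)) c≤M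

headAbove-insertInfix : ∀ b x L → fitsBefore x L ≡ false → HeadAbove b L → HeadAbove b (insertInfix x L)
headAbove-insertInfix b x []            ()
headAbove-insertInfix b x ((c , g) ∷ M) fits b<c rewrite fits with fitsBefore x M
... | true  = b<c
... | false = b<c

ordered-insertInfix : ∀ x L → Ordered L → Ordered (insertInfix x L)
ordered-insertInfix x []            _ = tt , [] , λ ()
ordered-insertInfix x ((b , f) ∷ L) (oL , b≤L , fb) with x ≤ᵇ b in e
... | true  = (oL , b≤L , fb) , (≤ᵇ-true⇒≤ e ∷ All.map (≤-trans (≤ᵇ-true⇒≤ e)) b≤L) , λ ()
... | false with fitsBefore x L in fits
...   | true  = (oL , fitsBefore⇒All≤ x L oL fits , λ ()) , (<⇒≤ (≤ᵇ-false⇒> e) ∷ b≤L) ,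
                λ _ → ≤ᵇ-false⇒> e
...   | false = ordered-insertInfix x L oL , All-insertInfix x L (<⇒≤ (≤ᵇ-false⇒> e)) b≤L ,
                λ f≡true → headAbove-insertInfix b x L fits (fb f≡true)

ordered-infixList : ∀ u → Ordered (infixList u)
ordered-infixList []      = tt
ordered-infixList (x ∷ u) = ordered-insertInfix x (infixList u) (ordered-infixList u)

All-infixList : ∀ {P : ℕ → Set} u → All P u → All P (labels (infixList u))
All-infixList []      _         = []
All-infixList (x ∷ u) (px ∷ pu) = All-insertInfix x (infixList u) px (All-infixList u pu)

containsLetter-insertInfix : ∀ y x L →
  containsLetter y (labels (insertInfix x L)) ≡ (x ≡ᵇ y) ∨ containsLetter y (labels L)
containsLetter-insertInfix y x []            = refl
containsLetter-insertInfix y x ((b , f) ∷ L) with x ≤ᵇ b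
... | true = refl
... | false with fitsBefore x L
...   | true  = ∨-swap (b ≡ᵇ y) (x ≡ᵇ y) _
...   | false = trans (cong ((b ≡ᵇ y) ∨_) (containsLetter-insertInfix y x L)) (∨-swap (b ≡ᵇ y) (x ≡ᵇ y) _)

containsLetter-infixList : ∀ y u → containsLetter y (labels (infixList u)) ≡ containsLetter y u
containsLetter-infixList y []      = refl
containsLetter-infixList y (x ∷ u) =
  trans (containsLetter-insertInfix y x (infixList u)) (cong ((x ≡ᵇ y) ∨_) (containsLetter-infixList y u))

All-lookupᵇ : ∀ {P : ℕ → Set} {a} l → All P l → containsLetter a l ≡ true → P a
All-lookupᵇ {P} {a} (x ∷ l) (px ∷ pl) e with x ≡ᵇ a in x≡a
... | true  = subst P (≡ᵇ-true⇒≡ x≡a) px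
... | false = All-lookupᵇ l pl e

All>⇒¬containsLetter : ∀ a l → All (suc a ≤_) l → containsLetter a l ≡ false
All>⇒¬containsLetter a l a<l with containsLetter a l in e
... | false = refl
... | true  = ⊥-elim (<-irrefl refl (All-lookupᵇ l a<l e))

leftOf⇒containsLetter : ∀ j k v → leftOf j k v ≡ true → containsLetter k v ≡ true
leftOf⇒containsLetter j k (x ∷ v) e with containsLetter k v in c
... | true  = ∨-zeroʳ (x ≡ᵇ k)
... | false with () ← trans (sym c) (leftOf⇒containsLetter j k v (∨-trueʳ (∧-zeroʳ (x ≡ᵇ j)) e))

leftOf-absent : ∀ j k v → containsLetter k v ≡ false → leftOf j k v ≡ false
leftOf-absent j k v k∉v with leftOf j k v in e
... | false = refl
... | true with () ← trans (sym k∉v) (leftOf⇒containsLetter j k v e)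

lastFlag : ℕ → List Entry → Bool
lastFlag a []            = false
lastFlag a ((b , f) ∷ L) = if containsLetter a (labels L) then lastFlag a L else (b ≡ᵇ a) ∧ f

lastFlag-absent : ∀ a L → containsLetter a (labels L) ≡ false → lastFlag a L ≡ false
lastFlag-absent a []            _ = refl
lastFlag-absent a ((b , f) ∷ L) e
  rewrite ∨-conicalˡ (b ≡ᵇ a) _ e | ∨-conicalʳ (b ≡ᵇ a) _ e = refl

lastFlag-∷-present : ∀ a b f L → containsLetter a (labels L) ≡ true → lastFlag a ((b , f) ∷ L) ≡ lastFlag a L
lastFlag-∷-present a b f L e rewrite e = refl

lastFlag-∷-absent : ∀ a b f L → containsLetter a (labels L) ≡ false →
                    lastFlag a ((b , f) ∷ L) ≡ (b ≡ᵇ a) ∧ f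
lastFlag-∷-absent a b f L e rewrite e = refl

lastFlag-∷-false : ∀ a b L → lastFlag a ((b , false) ∷ L) ≡ lastFlag a L
lastFlag-∷-false a b L with containsLetter a (labels L) in e
... | true  = refl
... | false = trans (∧-zeroʳ (b ≡ᵇ a)) (sym (lastFlag-absent a L e))

lastFlag-∷-other : ∀ {a b} f L → b ≢ a → lastFlag a ((b , f) ∷ L) ≡ lastFlag a L
lastFlag-∷-other {a} {b} f L b≢a with containsLetter a (labels L) in e
... | true  = refl
... | false rewrite ≢⇒≡ᵇ-false b≢a = sym (lastFlag-absent a L e)

lastFlag-insertInfix-≤ : ∀ {a x} L → x ≤ a → lastFlag a (insertInfix x L) ≡ lastFlag a L
lastFlag-insertInfix-≤ {a} {x} [] x≤a = lastFlag-∷-false a x []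
lastFlag-insertInfix-≤ {a} {x} ((b , f) ∷ L) x≤a with x ≤ᵇ b in e
... | true  = lastFlag-∷-false a x ((b , f) ∷ L)
... | false with fitsBefore x L
...   | true  = begin
  lastFlag a ((b , true) ∷ (x , false) ∷ L) ≡⟨ lastFlag-∷-other true ((x , false) ∷ L) b≢a ⟩
  lastFlag a ((x , false) ∷ L)              ≡⟨ lastFlag-∷-false a x L ⟩
  lastFlag a L                              ≡⟨ lastFlag-∷-other f L b≢a ⟨
  lastFlag a ((b , f) ∷ L)                  ∎
  where
  open ≡-Reasoning
  b≢a = <⇒≢ (<-≤-trans (≤ᵇ-false⇒> e) x≤a)
...   | false = trans (lastFlag-∷-other f (insertInfix x L) b≢a)
                      (trans (lastFlag-insertInfix-≤ L x≤a) (sym (lastFlag-∷-other f L b≢a)))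
  where
  b≢a = <⇒≢ (<-≤-trans (≤ᵇ-false⇒> e) x≤a)

lastFlag-insertInfix-suc : ∀ a L → Ordered L → containsLetter a (labels L) ≡ true →
                           lastFlag a (insertInfix (suc a) L) ≡ true
lastFlag-insertInfix-suc a ((b , f) ∷ M) (oM , b≤M , _) a∈L with suc a ≤ᵇ b in e
... | true = ⊥-elim (<⇒≱ (≤ᵇ-true⇒≤ e) (All-lookupᵇ (b ∷ labels M) (≤-refl ∷ b≤M) a∈L))
... | false with fitsBefore (suc a) M in fits
...   | true = trans (lastFlag-∷-absent a b true ((suc a , false) ∷ M) a∉a+1∷M)
                      (trans (∧-identityʳ (b ≡ᵇ a)) (∨-trueˡ a∉M a∈L))
  where
  a∉M : containsLetter a (labels M) ≡ false
  a∉M = All>⇒¬containsLetter a (labels M) (fitsBefore⇒All≤ (suc a) M oM fits)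
  a∉a+1∷M : containsLetter a (suc a ∷ labels M) ≡ false
  a∉a+1∷M = cong₂ _∨_ (≢⇒≡ᵇ-false (1+n≢n {a})) a∉M
...   | false with containsLetter a (labels M) in a∈M
...     | true  = trans (lastFlag-∷-present a b f (insertInfix (suc a) M) a∈M′) (lastFlag-insertInfix-suc a M oM a∈M)
  where
  a∈M′ : containsLetter a (labels (insertInfix (suc a) M)) ≡ true
  a∈M′ = trans (containsLetter-insertInfix a (suc a) M) (∨-introʳ (suc a ≡ᵇ a) a∈M)
...     | false = ⊥-elim (head-is-a M fits b≤M (≡ᵇ-true⇒≡ (∨-trueˡ refl a∈L)) a∈M)
  where
  -- the head c of M satisfies a = b ≤ c < suc a
  head-is-a : ∀ M → fitsBefore (suc a) M ≡ false → All (b ≤_) (labels M) → b ≡ a →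
              containsLetter a (labels M) ≡ false → ⊥
  head-is-a ((c , _) ∷ _) fits (b≤c ∷ _) refl a∉M
    with refl ← ≤-antisym (≤-pred (≤ᵇ-false⇒> fits)) b≤c
    with () ← trans (sym a∉M) (∨-introˡ (≡ᵇ-refl b))

lastFlag-insertInfix-> : ∀ a x L → Ordered L → suc a < x → containsLetter (suc a) (labels L) ≡ true →
                         lastFlag a (insertInfix x L) ≡ lastFlag a L
lastFlag-insertInfix-> a x ((b , f) ∷ M) (oM , b≤M , _) a+1<x a+1∈L with x ≤ᵇ b in e
... | true  = lastFlag-∷-false a x ((b , f) ∷ M)
... | false with fitsBefore x M in fits
...   | true  = begin
  lastFlag a ((b , true) ∷ (x , false) ∷ M) ≡⟨ lastFlag-∷-other true ((x , false) ∷ M) b≢a ⟩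
  lastFlag a ((x , false) ∷ M)              ≡⟨ lastFlag-∷-false a x M ⟩
  lastFlag a M                              ≡⟨ lastFlag-∷-other f M b≢a ⟨
  lastFlag a ((b , f) ∷ M)                  ∎
  where
  open ≡-Reasoning
  a+1∉M : containsLetter (suc a) (labels M) ≡ false
  a+1∉M = All>⇒¬containsLetter (suc a) (labels M) (All.map (≤-trans a+1<x) (fitsBefore⇒All≤ x M oM fits))
  b≢a : b ≢ a
  b≢a b≡a = 1+n≢n (trans (sym (≡ᵇ-true⇒≡ (∨-trueˡ a+1∉M a+1∈L))) b≡a)
...   | false with containsLetter a (labels M) in a∈M
...     | true  = begin
  lastFlag a ((b , f) ∷ insertInfix x M) ≡⟨ lastFlag-∷-present a b f (insertInfix x M) a∈xM ⟩
  lastFlag a (insertInfix x M)           ≡⟨ lastFlag-insertInfix-> a x M oM a+1<x a+1∈M ⟩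
  lastFlag a M                           ∎
  where
  open ≡-Reasoning
  a∈xM : containsLetter a (labels (insertInfix x M)) ≡ true
  a∈xM = trans (containsLetter-insertInfix a x M) (∨-introʳ (x ≡ᵇ a) a∈M)
  b≢a+1 : b ≢ suc a
  b≢a+1 b≡a+1 = <-irrefl b≡a+1 (s≤s (All-lookupᵇ (labels M) b≤M a∈M))
  a+1∈M : containsLetter (suc a) (labels M) ≡ true
  a+1∈M = ∨-trueʳ (≢⇒≡ᵇ-false b≢a+1) a+1∈L
...     | false = lastFlag-∷-absent a b f (insertInfix x M) a∉xM
  where
  a∉xM : containsLetter a (labels (insertInfix x M)) ≡ false
  a∉xM = trans (containsLetter-insertInfix a x M)
               (cong₂ _∨_ (≢⇒≡ᵇ-false (λ x≡a → <-asym a+1<x (subst (_< suc a) (sym x≡a) ≤-refl))) a∈M)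

lastFlag-infixList : ∀ a u → containsLetter a u ≡ true → containsLetter (suc a) u ≡ true →
                     lastFlag a (infixList u) ≡ leftOf (suc a) a u
lastFlag-infixList a (x ∷ v) a∈u a+1∈u with <-cmp x (suc a)
... | tri< x≤a x≢a+1 _ rewrite ≢⇒≡ᵇ-false x≢a+1 =
  trans (lastFlag-insertInfix-≤ (infixList v) (≤-pred x≤a)) (by-cases (containsLetter a v) a∈v a∉v)
  where
  a∈v : containsLetter a v ≡ true → lastFlag a (infixList v) ≡ leftOf (suc a) a v
  a∈v a∈v = lastFlag-infixList a v a∈v a+1∈u
  a∉v : containsLetter a v ≡ false → lastFlag a (infixList v) ≡ leftOf (suc a) a v
  a∉v a∉v = trans (lastFlag-absent a (infixList v) (trans (containsLetter-infixList a v) a∉v))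
                  (sym (leftOf-absent (suc a) a v a∉v))
... | tri≈ _ refl _ rewrite ≡ᵇ-refl (suc a) | ∨-trueʳ (≢⇒≡ᵇ-false (1+n≢n {a})) a∈u =
  lastFlag-insertInfix-suc a (infixList v) (ordered-infixList v)
    (trans (containsLetter-infixList a v) (∨-trueʳ (≢⇒≡ᵇ-false (1+n≢n {a})) a∈u))
... | tri> _ x≢a+1 a+1<x rewrite ≢⇒≡ᵇ-false x≢a+1 =
  trans (lastFlag-insertInfix-> a x (infixList v) (ordered-infixList v) a+1<x
           (trans (containsLetter-infixList (suc a) v) a+1∈u))
        (lastFlag-infixList a v (∨-trueʳ (≢⇒≡ᵇ-false x≢a) a∈u) a+1∈u)
  where
  x≢a : x ≢ a
  x≢a x≡a = <-asym a+1<x (subst (_< suc a) (sym x≡a) ≤-refl)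

NoGapsFrom : ℕ → List Entry → Set
NoGapsFrom k L = ∀ c → k ≤ c → containsLetter (suc c) (labels L) ≡ true → containsLetter c (labels L) ≡ true

StepsFlagged : List Entry → Set
StepsFlagged L = ∀ a → containsLetter a (labels L) ≡ true → containsLetter (suc a) (labels L) ≡ true →
                 lastFlag a L ≡ true

labelledFrom⇒All≥ : ∀ k L → LabelledFrom k L → All (k ≤_) (labels L)
labelledFrom⇒All≥ k []                  _           = []
labelledFrom⇒All≥ k ((a , true)  ∷ xs) (refl , lf) =
  ≤-refl ∷ All.map (≤-trans (n≤1+n k)) (labelledFrom⇒All≥ (suc k) xs lf)
labelledFrom⇒All≥ k ((a , false) ∷ xs) (refl , lf) = ≤-refl ∷ labelledFrom⇒All≥ k xs lf

labelledFrom⇒startPresent : ∀ k L → LabelledFrom k L → ∀ b → containsLetter b (labels L) ≡ true →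
                             containsLetter k (labels L) ≡ true
labelledFrom⇒startPresent k ((a , true)  ∷ xs) (refl , _) _ _ = ∨-introˡ (≡ᵇ-refl k)
labelledFrom⇒startPresent k ((a , false) ∷ xs) (refl , _) _ _ = ∨-introˡ (≡ᵇ-refl k)

labelledFrom⇒noGaps : ∀ k L → LabelledFrom k L → NoGapsFrom k L
labelledFrom⇒noGaps k ((a , true) ∷ xs) (refl , lf) c k≤c c+1∈L with m≤n⇒m<n∨m≡n k≤c
... | inj₂ refl = ∨-introˡ (≡ᵇ-refl k)
... | inj₁ k<c  = ∨-introʳ (k ≡ᵇ c) (labelledFrom⇒noGaps (suc k) xs lf c k<c (∨-trueʳ k≢c+1 c+1∈L))
  where k≢c+1 = ≢⇒≡ᵇ-false (<⇒≢ (s≤s k≤c))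
labelledFrom⇒noGaps k ((a , false) ∷ xs) (refl , lf) c k≤c c+1∈L =
  ∨-introʳ (k ≡ᵇ c) (labelledFrom⇒noGaps k xs lf c k≤c (∨-trueʳ (≢⇒≡ᵇ-false (<⇒≢ (s≤s k≤c))) c+1∈L))

sucPresent-tail : ∀ {a c} xs → All (c ≤_) xs → containsLetter a xs ≡ true →
                  containsLetter (suc a) (c ∷ xs) ≡ true → containsLetter (suc a) xs ≡ true
sucPresent-tail {a} {c} xs c≤xs a∈xs =
  ∨-trueʳ (≢⇒≡ᵇ-false (λ c≡a+1 → <-irrefl c≡a+1 (s≤s (All-lookupᵇ xs c≤xs a∈xs))))

labelledFrom⇒stepsFlagged : ∀ k L → LabelledFrom k L → StepsFlagged L
labelledFrom⇒stepsFlagged k ((c , true) ∷ xs) (refl , lf) a a∈L a+1∈L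
  with containsLetter a (labels xs) in a∈xs
... | true  = labelledFrom⇒stepsFlagged (suc c) xs lf a a∈xs
                (sucPresent-tail (labels xs) (All.map (≤-trans (n≤1+n c)) (labelledFrom⇒All≥ (suc c) xs lf))
                   a∈xs a+1∈L)
... | false = trans (∧-identityʳ (c ≡ᵇ a)) (∨-trueˡ refl a∈L)
labelledFrom⇒stepsFlagged k ((c , false) ∷ xs) (refl , lf) a a∈L a+1∈L
  with containsLetter a (labels xs) in a∈xs
... | true  = labelledFrom⇒stepsFlagged c xs lf a a∈xs
                (sucPresent-tail (labels xs) (labelledFrom⇒All≥ c xs lf) a∈xs a+1∈L)
... | false with refl ← ≡ᵇ-true⇒≡ {c} {a} (∨-trueˡ refl a∈L)
            with () ← trans (sym a∈xs) (labelledFrom⇒startPresent c xs lf (suc c)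
                        (∨-trueʳ (≢⇒≡ᵇ-false (1+n≢n {a} ∘ sym)) a+1∈L))

noGapsFrom⇒min≤ : ∀ {k a} L → NoGapsFrom k L → All (a ≤_) (labels L) →
                  containsLetter a (labels L) ≡ true → a ≤ k
noGapsFrom⇒min≤ {k} {zero}  L _      _   _   = z≤n
noGapsFrom⇒min≤ {k} {suc c} L noGaps a≤L a∈L with k ≤? c
... | yes k≤c = ⊥-elim (<-irrefl refl (All-lookupᵇ (labels L) a≤L (noGaps c k≤c a∈L)))
... | no  k≰c = ≰⇒> k≰c

headAbove⇒All> : ∀ a xs → Ordered xs → HeadAbove a xs → All (a <_) (labels xs)
headAbove⇒All> a ((c , _) ∷ M) (_ , c≤M , _) a<c = a<c ∷ All.map (<-≤-trans a<c) c≤M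

stepsFlagged-tail : ∀ e xs → StepsFlagged (e ∷ xs) → StepsFlagged xs
stepsFlagged-tail (b , f) xs flags a a∈xs a+1∈xs =
  trans (sym (lastFlag-∷-present a b f xs a∈xs))
        (flags a (∨-introʳ (b ≡ᵇ a) a∈xs) (∨-introʳ (b ≡ᵇ suc a) a+1∈xs))

noGaps∧stepsFlagged⇒labelledFrom : ∀ k L → Ordered L → All (k ≤_) (labels L) →
                                   NoGapsFrom k L → StepsFlagged L → LabelledFrom k L
noGaps∧stepsFlagged⇒labelledFrom k [] _ _ _ _ = tt
noGaps∧stepsFlagged⇒labelledFrom k ((a , f) ∷ xs) (oxs , a≤xs , fa) (k≤a ∷ k≤xs) noGaps flags
  with refl ← ≤-antisym k≤a
                 (noGapsFrom⇒min≤ ((a , f) ∷ xs) noGaps (≤-refl ∷ a≤xs) (∨-introˡ (≡ᵇ-refl a)))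
  with f
... | true  = refl , noGaps∧stepsFlagged⇒labelledFrom (suc a) xs oxs (headAbove⇒All> a xs oxs (fa refl))
                       noGaps′ (stepsFlagged-tail (a , true) xs flags)
  where
  noGaps′ : NoGapsFrom (suc a) xs
  noGaps′ c a<c c+1∈xs =
    ∨-trueʳ (≢⇒≡ᵇ-false (<⇒≢ a<c)) (noGaps c (<⇒≤ a<c) (∨-introʳ (a ≡ᵇ suc c) c+1∈xs))
... | false = refl , noGaps∧stepsFlagged⇒labelledFrom a xs oxs a≤xs noGaps′ (stepsFlagged-tail (a , false) xs flags)
  where
  noGaps′ : NoGapsFrom a xs
  noGaps′ c a≤c c+1∈xs with a ≡ᵇ c in a≡c | noGaps c a≤c (∨-introʳ (a ≡ᵇ suc c) c+1∈xs)
  ... | false | c∈xs = c∈xs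
  ... | true  | _ with refl ← ≡ᵇ-true⇒≡ {a} {c} a≡c with containsLetter a (labels xs) in a∈xs
  ...   | true  = refl
  ...   | false with () ← trans (sym (trans (lastFlag-∷-false a a xs) (lastFlag-absent a xs a∈xs)))
                               (flags a (∨-introˡ a≡c) (∨-introʳ (a ≡ᵇ suc a) c+1∈xs))

labelledFrom⇔noGaps∧stepsFlagged : ∀ k L → Ordered L → All (k ≤_) (labels L) →
  LabelledFrom k L ⇔ (NoGapsFrom k L × StepsFlagged L)
labelledFrom⇔noGaps∧stepsFlagged k L oL k≤L = mk⇔
  (λ lf → labelledFrom⇒noGaps k L lf , labelledFrom⇒stepsFlagged k L lf)
  (λ (noGaps , flags) → noGaps∧stepsFlagged⇒labelledFrom k L oL k≤L noGaps flags)

-- Highest weight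

replaceLeftmost-nothing⇒absent : ∀ j k u → replaceLeftmost j k u ≡ nothing → containsLetter j u ≡ false
replaceLeftmost-nothing⇒absent j k []      _ = refl
replaceLeftmost-nothing⇒absent j k (x ∷ u) e with x ≡ᵇ j
... | false with replaceLeftmost j k u in r
...   | nothing = replaceLeftmost-nothing⇒absent j k u r

absent⇒replaceLeftmost-nothing : ∀ j k u → containsLetter j u ≡ false → replaceLeftmost j k u ≡ nothing
absent⇒replaceLeftmost-nothing j k []      _ = refl
absent⇒replaceLeftmost-nothing j k (x ∷ u) e with x ≡ᵇ j
... | false rewrite absent⇒replaceLeftmost-nothing j k u e = refl

quasiRaise-undefined⇔ : ∀ i u →
  quasiRaise i u ≡ nothing ⇔ (containsLetter (suc i) u ≡ true → leftOf (suc i) i u ≡ true)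
quasiRaise-undefined⇔ i u with leftOf (suc i) i u
... | true  = mk⇔ (λ _ _ → refl) (λ _ → refl)
... | false = mk⇔ (λ r i+1∈u → trans (sym (replaceLeftmost-nothing⇒absent (suc i) i u r)) i+1∈u) absent
  where
  absent : (containsLetter (suc i) u ≡ true → false ≡ true) → replaceLeftmost (suc i) i u ≡ nothing
  absent h with containsLetter (suc i) u in i+1∉u
  ... | false = absent⇒replaceLeftmost-nothing (suc i) i u i+1∉u
  ... | true with () ← h refl

highestWeight⇔noGaps∧stepsFlagged : ∀ u → All (1 ≤_) u →
  HighestWeight u ⇔ (NoGapsFrom 1 (infixList u) × StepsFlagged (infixList u))
highestWeight⇔noGaps∧stepsFlagged u pos = mk⇔ to from
  where
  inL⇒inu : ∀ a → containsLetter a (labels (infixList u)) ≡ true → containsLetter a u ≡ true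
  inL⇒inu a = trans (sym (containsLetter-infixList a u))
  inu⇒inL : ∀ a → containsLetter a u ≡ true → containsLetter a (labels (infixList u)) ≡ true
  inu⇒inL a = trans (containsLetter-infixList a u)
  raisesBlocked : HighestWeight u → ∀ a → 1 ≤ a → containsLetter (suc a) u ≡ true →
                  leftOf (suc a) a u ≡ true
  raisesBlocked hw a 1≤a = Equivalence.to (quasiRaise-undefined⇔ a u) (hw a 1≤a)

  to : HighestWeight u → NoGapsFrom 1 (infixList u) × StepsFlagged (infixList u)
  to hw = (λ c 1≤c c+1∈L →
             inu⇒inL c (leftOf⇒containsLetter (suc c) c u (raisesBlocked hw c 1≤c (inL⇒inu (suc c) c+1∈L))))
        , (λ a a∈L a+1∈L → let a+1∈u = inL⇒inu (suc a) a+1∈L in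
             trans (lastFlag-infixList a u (inL⇒inu a a∈L) a+1∈u)
                   (raisesBlocked hw a (All-lookupᵇ _ (All-infixList u pos) a∈L) a+1∈u))

  from : NoGapsFrom 1 (infixList u) × StepsFlagged (infixList u) → HighestWeight u
  from (noGaps , flags) i 1≤i = Equivalence.from (quasiRaise-undefined⇔ i u) λ i+1∈u →
    let i∈L = noGaps i 1≤i (inu⇒inL (suc i) i+1∈u) in
    trans (sym (lastFlag-infixList i u (inL⇒inu i i∈L) i+1∈u)) (flags i i∈L (inu⇒inL (suc i) i+1∈u))

proposition11 : (u : Word) → All (λ x → 1 ≤ x) u →
    (HighestWeight u ⇔ IntervalsLabelled (rtree u))
proposition11 u pos = begin
  HighestWeight u
    ≈⟨ highestWeight⇔noGaps∧stepsFlagged u pos ⟩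
  (NoGapsFrom 1 (infixList u) × StepsFlagged (infixList u))
    ≈⟨ labelledFrom⇔noGaps∧stepsFlagged 1 (infixList u) (ordered-infixList u) (All-infixList u pos) ⟨
  LabelledFrom 1 (infixList u)
    ≡⟨ cong (LabelledFrom 1) (infixNodes-rtree u) ⟨
  LabelledFrom 1 (infixNodes (rtree u))
    ≈⟨ intervalsLabelled⇔labelledFrom (rtree u) ⟨
  IntervalsLabelled (rtree u) ∎
  where open SetoidReasoning (⇔-setoid 0ℓ)
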